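{- Let $\mathcal{P} = \langle P, \prec \rangle$ be a strict partially ordered set, considered in the language $\{\prec, =\}$ with a constant symbol for every element of $P$. The following are equivalent: (1) $\mathcal{P}$ is not equationally Noetherian; (2) $\mathcal{P}$ contains a $\prec$-perfectly non-Noetherian substructure or a non-Noetherian clique; (3) there is a subset $B \subseteq P$ whose upper base cone or lower base cone is infinitely generated.
   Context: $\mathcal{P}$ is equationally Noetherian if for every finite set of variables $X$, every system of equations (atomic formulas $w_1 \prec w_2$ or $w_1 = w_2$ with $w_i$ variables or constants) has the same solution set as some finite subsystem. $\mathcal{P}$ contains a $\prec$-perfectly non-Noetherian substructure if there are sequences $(a_i)_{i\in\mathbb{N}}$, $(b_i)_{i\in\mathbb{N}}$ in $P$, all elements $a_1,b_1,a_2,b_2,\dots$ pairwise different, such that either ($a_i \not\prec b_i$ for all $i$ and $a_i \prec b_j$ for all $j<i$) or ($b_i \not\prec a_i$ for all $i$ and $b_j \prec a_i$ for all $j<i$). $\mathcal{P}$ contains a non-Noetherian clique if there is a sequence $(a_i)_{i\in\mathbb{N}}$ in $P$ such that either $a_i \prec a_j$ for all $j<i$, or $a_j \prec a_i$ for all $j < i$ (the condition $a_i \not\prec a_i$ holds automatically). For $B \subseteq P$ let $B^{\uparrow} = \{x : b \prec x\ \forall b\in B\}$, $B^{\downarrow} = \{x : x \prec b\ \forall b \in B\}$; the upper base cone $(B,B^\uparrow)$ is finitely generated if some finite $B_0\subseteq B$ has $B_0^\uparrow = B^\uparrow$, and infinitely generated otherwise; similarly for the lower base cone. -}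

module Defs where

open import Level using (Level; 0ℓ) renaming (suc to lsuc)
open import Data.Nat using (ℕ; zero; suc; _<_)
open import Data.Fin using (Fin)
open import Data.Sum using (_⊎_)
open import Data.Product using (Σ; ∃; _×_; _,_)
open import Data.List using (List)
open import Data.List.Membership.Propositional using (_∈_)
open import Relation.Nullary using (¬_)
open import Relation.Binary.PropositionalEquality using (_≡_; _≢_)
open import Relation.Binary.Structures using (IsStrictPartialOrder)
open import Function.Bundles using (_⇔_)

DependentChoice : (ℓ : Level) → Set (lsuc ℓ)
DependentChoice ℓ = {A : Set ℓ} (R : A → A → Set ℓ) → (∀ x → ∃ (R x)) →
  ∀ x → ∃ λ (f : ℕ → A) → f 0 ≡ x × (∀ n → R (f n) (f (suc n)))

module _ (P : Set) (_≺_ : P → P → Set) where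

  Term : ℕ → Set
  Term n = Fin n ⊎ P

  data Atom (n : ℕ) : Set where
    _≺ₐ_ : Term n → Term n → Atom n
    _≐_  : Term n → Term n → Atom n

  eval : {n : ℕ} → (Fin n → P) → Term n → P
  eval σ (Data.Sum.inj₁ x) = σ x
  eval σ (Data.Sum.inj₂ c) = c

  Sat : {n : ℕ} → (Fin n → P) → Atom n → Set
  Sat σ (s ≺ₐ t) = eval σ s ≺ eval σ t
  Sat σ (s ≐ t)  = eval σ s ≡ eval σ t

  System : ℕ → Set₁
  System n = Atom n → Set

  Solves : {n : ℕ} → (Fin n → P) → System n → Set
  Solves σ S = ∀ a → S a → Sat σ a

  SolvesList : {n : ℕ} → (Fin n → P) → List (Atom n) → Set
  SolvesList σ L = ∀ a → a ∈ L → Sat σ a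

  HasFiniteEquivalentSubsystem : {n : ℕ} → System n → Set
  HasFiniteEquivalentSubsystem {n} S =
    Σ (List (Atom n)) λ L → (∀ a → a ∈ L → S a) ×
      (∀ (σ : Fin n → P) → Solves σ S ⇔ SolvesList σ L)

  EquationallyNoetherian : Set₁
  EquationallyNoetherian = ∀ (n : ℕ) (S : System n) → HasFiniteEquivalentSubsystem S

  PairwiseDifferent : (ℕ → P) → (ℕ → P) → Set
  PairwiseDifferent a b =
    (∀ i j → i ≢ j → a i ≢ a j) × (∀ i j → i ≢ j → b i ≢ b j) × (∀ i j → a i ≢ b j)

  PerfectlyNonNoetherian : Set
  PerfectlyNonNoetherian =
    Σ (ℕ → P) λ a → Σ (ℕ → P) λ b → PairwiseDifferent a b ×
      ( ((∀ i → ¬ (a i ≺ b i)) × (∀ i j → j < i → a i ≺ b j))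
      ⊎ ((∀ i → ¬ (b i ≺ a i)) × (∀ i j → j < i → b j ≺ a i)) )

  NonNoetherianClique : Set
  NonNoetherianClique =
    Σ (ℕ → P) λ a → (∀ i j → j < i → a i ≺ a j) ⊎ (∀ i j → j < i → a j ≺ a i)

  Up : (P → Set) → P → Set
  Up B x = ∀ b → B b → b ≺ x

  Down : (P → Set) → P → Set
  Down B x = ∀ b → B b → x ≺ b

  UpL : List P → P → Set
  UpL B₀ x = ∀ b → b ∈ B₀ → b ≺ x

  DownL : List P → P → Set
  DownL B₀ x = ∀ b → b ∈ B₀ → x ≺ b

  UpperConeFinitelyGenerated : (P → Set) → Set
  UpperConeFinitelyGenerated B =
    Σ (List P) λ B₀ → (∀ b → b ∈ B₀ → B b) × (∀ x → UpL B₀ x ⇔ Up B x)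

  LowerConeFinitelyGenerated : (P → Set) → Set
  LowerConeFinitelyGenerated B =
    Σ (List P) λ B₀ → (∀ b → b ∈ B₀ → B b) × (∀ x → DownL B₀ x ⇔ Down B x)

  UpperConeInfinitelyGenerated : (P → Set) → Set
  UpperConeInfinitelyGenerated B = ¬ UpperConeFinitelyGenerated B

  LowerConeInfinitelyGenerated : (P → Set) → Set
  LowerConeInfinitelyGenerated B = ¬ LowerConeFinitelyGenerated B

-- A system of equations in the variables x₁ … xₙ splits by shape: atoms between
-- two variables are finitely many, atoms between two constants are decided
-- outright, and the atoms c ≺ xᵢ, xᵢ ≺ c and xᵢ = c with c ranging over a set C
-- constrain xᵢ to the upper cone of C, the lower cone of C, or a set with at
-- most one point.  Hence P is equationally Noetherian exactly when every base
-- cone is finitely generated; conversely an infinitely generated upper cone of B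
-- gives a one-variable system with no finite equivalent subsystem.
--
-- If the upper cone of B is not finitely generated, then for every finite G ⊆ B
-- some a lies above G but not above some b ∈ B.  Iterating with dependent
-- choice gives aᵢ above b₀ … bᵢ₋₁ but not above bᵢ: a perfectly non-Noetherian
-- substructure.  Conversely, for such sequences (or a clique, taking aᵢ = bᵢ)
-- the cone of {bᵢ} is infinitely generated: a finite part of {bᵢ} lies among
-- b₀ … bₖ₋₁, hence below aₖ, while bₖ is not below aₖ.

module Submission where

open import Defs
open import Level using (0ℓ; lift; lower) renaming (suc to lsuc)
open import Axiom.ExcludedMiddle using (ExcludedMiddle)
open import Data.Empty using (⊥-elim)
open import Data.Fin using (Fin; zero; suc)
open import Data.List using (List; []; _∷_; _++_; map)
open import Data.List.Membership.Propositional using (_∈_)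
open import Data.List.Membership.Propositional.Properties
  using (∈-map⁺; ∈-map⁻; ∈-++⁺ˡ; ∈-++⁺ʳ; ∈-++⁻)
open import Data.List.Relation.Binary.Subset.Propositional using (_⊆_)
open import Data.List.Relation.Unary.Any using (here; there)
open import Data.Nat using (ℕ; zero; suc; _<_; _≤′_; ≤′-refl; ≤′-step; s≤s; _⊔_)
open import Data.Nat.Properties using (<-cmp; ≤⇒≤′; ≤-trans; m≤m⊔n; m≤n⊔m; m≤n⇒m≤1+n)
open import Data.Product using (Σ; ∃; ∃₂; _×_; _,_; proj₁; proj₂)
open import Data.Sum using (_⊎_; inj₁; inj₂; [_,_]′)
open import Function using (_∘_; flip)
open import Function.Bundles using (_⇔_; mk⇔; Equivalence)
open import Function.Construct.Identity using (⇔-id)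
open import Relation.Binary.Definitions using (tri<; tri≈; tri>)
open import Relation.Binary.PropositionalEquality using (_≡_; _≢_; refl; sym; trans; subst)
open import Relation.Binary.Structures using (IsStrictPartialOrder)
open import Relation.Nullary using (¬_; Dec; yes; no)
open import Relation.Nullary.Decidable using (map′; decidable-stable)
open import Relation.Unary using (_∪_; ⋃)

open Equivalence using (to; from)

<-separated⇒injective : {A : Set} (f : ℕ → A) → (∀ {i k} → i < k → f i ≢ f k) →
                        ∀ i k → i ≢ k → f i ≢ f k
<-separated⇒injective f separated i k i≢k with <-cmp i k
... | tri< i<k _ _ = separated i<k
... | tri≈ _ i≡k _ = λ _ → i≢k i≡k
... | tri> _ _ k<i = separated k<i ∘ sym

⊆-chain : {A : Set} (G : ℕ → List A) → (∀ n → G n ⊆ G (suc n)) →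
          ∀ {j i} → j ≤′ i → G j ⊆ G i
⊆-chain G grows ≤′-refl        x∈ = x∈
⊆-chain G grows (≤′-step j≤′i) x∈ = grows _ (⊆-chain G grows j≤′i x∈)

preimage : {A B : Set} {C : A → Set} (f : A → B) (ys : List B) →
           (∀ y → y ∈ ys → ∃ λ x → C x × y ≡ f x) →
           ∃ λ xs → (∀ x → x ∈ xs → C x) × map f xs ≡ ys
preimage f []       _ = [] , (λ _ ()) , refl
preimage f (y ∷ ys) h with h y (here refl) | preimage f ys (λ y′ → h y′ ∘ there)
... | x , Cx , refl | xs , Cxs , refl =
  x ∷ xs , (λ { _ (here refl) → Cx ; z (there z∈) → Cxs z z∈ }) , refl

module _ (P : Set) (R : P → P → Set) where

  upperCone-generatedBy : {B : P → Set} (B₀ : List P) → (∀ b → b ∈ B₀ → B b) →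
                          (∀ x → UpL P R B₀ x → Up P R B x) →
                          UpperConeFinitelyGenerated P R B
  upperCone-generatedBy B₀ B₀⊆B generates =
    B₀ , B₀⊆B , λ x → mk⇔ (generates x) (λ above b b∈ → above b (B₀⊆B b b∈))

  Image : (ℕ → P) → P → Set
  Image b x = ∃ λ i → b i ≡ x

  -- Both kinds of perfectly non-Noetherian substructure (R = ≺ or its converse)
  -- and non-Noetherian cliques (a = b) have this shape.
  NonNoetherianPair : (ℕ → P) → (ℕ → P) → Set
  NonNoetherianPair a b = (∀ i → ¬ R (b i) (a i)) × (∀ i j → j < i → R (b j) (a i))

  nonNoetherianPair⇒a-injective : ∀ {a b} → NonNoetherianPair a b →
                                  ∀ i k → i ≢ k → a i ≢ a k
  nonNoetherianPair⇒a-injective {a} {b} (b⊀a , below) =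
    <-separated⇒injective a λ {i} i<k ai≡ak →
      b⊀a i (subst (R (b i)) (sym ai≡ak) (below _ i i<k))

  nonNoetherianPair⇒b-injective : ∀ {a b} → NonNoetherianPair a b →
                                  ∀ i k → i ≢ k → b i ≢ b k
  nonNoetherianPair⇒b-injective {a} {b} (b⊀a , below) =
    <-separated⇒injective b λ {i} {k} i<k bi≡bk →
      b⊀a k (subst (λ z → R z (a k)) bi≡bk (below k i i<k))

  indices-bounded : (b : ℕ → P) (B₀ : List P) → (∀ x → x ∈ B₀ → Image b x) →
                    ∃ λ k → ∀ x → x ∈ B₀ → ∃ λ i → i < k × b i ≡ x
  indices-bounded b []       _ = 0 , λ _ ()
  indices-bounded b (y ∷ B₀) h with h y (here refl) | indices-bounded b B₀ (λ x → h x ∘ there)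
  ... | i , bi≡y | k , bounded = suc (i ⊔ k) , λ where
    _ (here refl) → i , s≤s (m≤m⊔n i k) , bi≡y
    x (there x∈)  → let j , j<k , bj≡x = bounded x x∈
                    in j , ≤-trans j<k (m≤n⇒m≤1+n (m≤n⊔m i k)) , bj≡x

  nonNoetherianPair⇒image-infinitelyGenerated :
    ∀ {a b} → NonNoetherianPair a b → ¬ UpperConeFinitelyGenerated P R (Image b)
  nonNoetherianPair⇒image-infinitelyGenerated {a} {b} (b⊀a , below) (B₀ , B₀⊆B , generates)
    with indices-bounded b B₀ B₀⊆B
  ... | k , bounded = b⊀a k (to (generates (a k)) ak-above-B₀ (b k) (k , refl))
    where
      ak-above-B₀ : UpL P R B₀ (a k)
      ak-above-B₀ x x∈ with bounded x x∈
      ... | i , i<k , refl = below k i i<k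

infinitelyGenerated⇒¬equationallyNoetherian :
  (P : Set) (_≺_ : P → P → Set) (R : P → P → Set) (atom : P → Atom P _≺_ 1) →
  (∀ x c → Sat P _≺_ (λ _ → x) (atom c) ⇔ R c x) →
  (B : P → Set) → ¬ UpperConeFinitelyGenerated P R B → ¬ EquationallyNoetherian P _≺_
infinitelyGenerated⇒¬equationallyNoetherian P _≺_ R atom sat B infinite noetherian
  with noetherian 1 (λ e → ∃ λ c → B c × e ≡ atom c)
... | L , L⊆S , equivalent with preimage atom L L⊆S
... | B₀ , B₀⊆B , refl = infinite (upperCone-generatedBy P R B₀ B₀⊆B above)
  where
    above : ∀ x → UpL P R B₀ x → Up P R B x
    above x x-above b Bb =
      to (sat x b) (from (equivalent (λ _ → x)) solves (atom b) (b , Bb , refl))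
      where
        solves : SolvesList P _≺_ (λ _ → x) (map atom B₀)
        solves e e∈ with ∈-map⁻ atom e∈
        ... | c , c∈ , refl = from (sat x c) (x-above c c∈)

module _ (em : ExcludedMiddle (lsuc 0ℓ)) where

  dec : (Q : Set) → Dec Q
  dec Q = map′ lower lift em

  dne : {Q : Set} → ¬ ¬ Q → Q
  dne = decidable-stable (dec _)

  leftUnique⇒upperCone-finitelyGenerated :
    (P : Set) (R : P → P → Set) → (∀ {c c′ x} → R c x → R c′ x → c ≡ c′) →
    ∀ B → UpperConeFinitelyGenerated P R B
  leftUnique⇒upperCone-finitelyGenerated P R unique B with dec (∃ B)
  ... | no ∄B = upperCone-generatedBy P R [] (λ _ ()) λ _ _ b Bb → ⊥-elim (∄B (b , Bb))
  ... | yes (c₀ , Bc₀) with dec (∃ λ c → B c × c ≢ c₀)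
  ...   | yes (c₁ , Bc₁ , c₁≢c₀) =
    upperCone-generatedBy P R (c₀ ∷ c₁ ∷ [])
      (λ { _ (here refl) → Bc₀ ; _ (there (here refl)) → Bc₁ })
      λ _ above → ⊥-elim (c₁≢c₀ (unique (above c₁ (there (here refl))) (above c₀ (here refl))))
  ...   | no ∄c₁ =
    upperCone-generatedBy P R (c₀ ∷ []) (λ { _ (here refl) → Bc₀ })
      λ x above b Bb → subst (λ c → R c x) (sym (dne λ b≢c₀ → ∄c₁ (b , Bb , b≢c₀)))
                             (above c₀ (here refl))

  module _ (P : Set) (_≺_ : P → P → Set) {n : ℕ} (S : System P _≺_ n) where

    FinitelyEntailed : (Atom P _≺_ n → Set) → Set
    FinitelyEntailed T = ∃ λ L → (∀ e → e ∈ L → S e) ×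
      (∀ σ → SolvesList P _≺_ σ L → ∀ e → T e → S e → Sat P _≺_ σ e)

    finitelyEntailed-⊆ : ∀ {T T′} → (∀ e → T e → T′ e) →
                         FinitelyEntailed T′ → FinitelyEntailed T
    finitelyEntailed-⊆ T⊆T′ (L , L⊆S , entails) =
      L , L⊆S , λ σ solves e → entails σ solves e ∘ T⊆T′ e

    finitelyEntailed-∪ : ∀ {T₁ T₂} → FinitelyEntailed T₁ → FinitelyEntailed T₂ →
                         FinitelyEntailed (T₁ ∪ T₂)
    finitelyEntailed-∪ (L₁ , L₁⊆S , entails₁) (L₂ , L₂⊆S , entails₂) =
      L₁ ++ L₂ , (λ e → [ L₁⊆S e , L₂⊆S e ]′ ∘ ∈-++⁻ L₁) ,
      λ σ solves e → [ entails₁ σ (λ e′ → solves e′ ∘ ∈-++⁺ˡ) e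
                     , entails₂ σ (λ e′ → solves e′ ∘ ∈-++⁺ʳ L₁) e ]′

    finitelyEntailed-⋃ : ∀ {m} {T : Fin m → Atom P _≺_ n → Set} →
                         (∀ i → FinitelyEntailed (T i)) → FinitelyEntailed (⋃ (Fin m) T)
    finitelyEntailed-⋃ {zero} _ = [] , (λ _ ()) , λ { _ _ _ (() , _) }
    finitelyEntailed-⋃ {suc m} {T} entailed =
      finitelyEntailed-⊆ split
        (finitelyEntailed-∪ (entailed zero) (finitelyEntailed-⋃ (entailed ∘ suc)))
      where
        split : ∀ e → ⋃ (Fin (suc m)) T e → (T zero ∪ ⋃ (Fin m) (T ∘ suc)) e
        split _ (zero  , t) = inj₁ t
        split _ (suc i , t) = inj₂ (i , t)

    finitelyEntailed-singleton : (e₀ : Atom P _≺_ n) → FinitelyEntailed (_≡ e₀)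
    finitelyEntailed-singleton e₀ with dec (S e₀)
    ... | yes Se₀ = e₀ ∷ [] , (λ { _ (here refl) → Se₀ }) ,
                    λ { _ solves _ refl _ → solves e₀ (here refl) }
    ... | no ¬Se₀ = [] , (λ _ ()) , λ { _ _ _ refl Se₀ → ⊥-elim (¬Se₀ Se₀) }

    finitelyEntailed-closed : ∀ {T} → (∀ e → T e → ∀ σ σ′ → Sat P _≺_ σ e → Sat P _≺_ σ′ e) →
                              FinitelyEntailed T
    finitelyEntailed-closed {T} closed
      with dec (∃ λ e → T e × S e × ∃ λ σ → ¬ Sat P _≺_ σ e)
    ... | yes (e , Te , Se , σ , ¬sat) =
      e ∷ [] , (λ { _ (here refl) → Se }) ,
      λ σ′ solves _ _ _ → ⊥-elim (¬sat (closed e Te σ′ σ (solves e (here refl))))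
    ... | no ∄ = [] , (λ _ ()) , λ σ _ e Te Se → dne λ ¬sat → ∄ (e , Te , Se , σ , ¬sat)

    finitelyEntailed-cone : (x : Fin n) (atom : P → Atom P _≺_ n) (R : P → P → Set) →
                            (∀ σ c → Sat P _≺_ σ (atom c) ⇔ R c (σ x)) →
                            UpperConeFinitelyGenerated P R (S ∘ atom) →
                            FinitelyEntailed (λ e → ∃ λ c → e ≡ atom c)
    finitelyEntailed-cone x atom R sat (B₀ , B₀⊆C , generates) =
      map atom B₀ ,
      (λ e e∈ → let c , c∈ , e≡ = ∈-map⁻ atom e∈ in subst S (sym e≡) (B₀⊆C c c∈)) ,
      λ { σ solves _ (c , refl) Sc →
            from (sat σ c) (to (generates (σ x)) (above-B₀ σ solves) c Sc) }
      where
        above-B₀ : ∀ σ → SolvesList P _≺_ σ (map atom B₀) → UpL P R B₀ (σ x)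
        above-B₀ σ solves b b∈ = to (sat σ b) (solves (atom b) (∈-map⁺ atom b∈))

    finitelyEntailed-relation :
      (atom : Term P _≺_ n → Term P _≺_ n → Atom P _≺_ n) (Q : P → P → Set) →
      (∀ σ s t → Sat P _≺_ σ (atom s t) ⇔ Q (eval P _≺_ σ s) (eval P _≺_ σ t)) →
      (∀ C → UpperConeFinitelyGenerated P Q C) → (∀ C → LowerConeFinitelyGenerated P Q C) →
      FinitelyEntailed (λ e → ∃₂ λ s t → e ≡ atom s t)
    finitelyEntailed-relation atom Q sat upper lower =
      finitelyEntailed-⊆ byShape
        (finitelyEntailed-∪ varVar (finitelyEntailed-∪ constConst
          (finitelyEntailed-∪ constVar varConst)))
      where
        VarVar ConstConst ConstVar VarConst : Atom P _≺_ n → Set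
        VarVar     = ⋃ (Fin n) λ x → ⋃ (Fin n) λ y → _≡ atom (inj₁ x) (inj₁ y)
        ConstConst = λ e → ∃₂ λ c d → e ≡ atom (inj₂ c) (inj₂ d)
        ConstVar   = ⋃ (Fin n) λ x e → ∃ λ c → e ≡ atom (inj₂ c) (inj₁ x)
        VarConst   = ⋃ (Fin n) λ x e → ∃ λ c → e ≡ atom (inj₁ x) (inj₂ c)

        byShape : ∀ e → (∃₂ λ s t → e ≡ atom s t) → (VarVar ∪ ConstConst ∪ ConstVar ∪ VarConst) e
        byShape _ (inj₁ x , inj₁ y , refl) = inj₁ (x , y , refl)
        byShape _ (inj₂ c , inj₂ d , refl) = inj₂ (inj₁ (c , d , refl))
        byShape _ (inj₂ c , inj₁ x , refl) = inj₂ (inj₂ (inj₁ (x , c , refl)))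
        byShape _ (inj₁ x , inj₂ c , refl) = inj₂ (inj₂ (inj₂ (x , c , refl)))

        varVar : FinitelyEntailed VarVar
        varVar = finitelyEntailed-⋃ λ x → finitelyEntailed-⋃ λ y →
                   finitelyEntailed-singleton (atom (inj₁ x) (inj₁ y))

        constConst : FinitelyEntailed ConstConst
        constConst = finitelyEntailed-closed λ { _ (c , d , refl) σ σ′ →
                       from (sat σ′ (inj₂ c) (inj₂ d)) ∘ to (sat σ (inj₂ c) (inj₂ d)) }

        constVar : FinitelyEntailed ConstVar
        constVar = finitelyEntailed-⋃ λ x →
          finitelyEntailed-cone x (λ c → atom (inj₂ c) (inj₁ x)) Q
            (λ σ c → sat σ (inj₂ c) (inj₁ x)) (upper _)

        -- A lower cone of Q is, definitionally, an upper cone of flip Q.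
        varConst : FinitelyEntailed VarConst
        varConst = finitelyEntailed-⋃ λ x →
          finitelyEntailed-cone x (λ c → atom (inj₁ x) (inj₂ c)) (flip Q)
            (λ σ c → sat σ (inj₁ x) (inj₂ c)) (lower _)

  finitelyGenerated⇒equationallyNoetherian :
    (P : Set) (_≺_ : P → P → Set) →
    (∀ B → UpperConeFinitelyGenerated P _≺_ B) → (∀ B → LowerConeFinitelyGenerated P _≺_ B) →
    EquationallyNoetherian P _≺_
  finitelyGenerated⇒equationallyNoetherian P _≺_ upper lower n S
    with finitelyEntailed-∪ P _≺_ S
           (finitelyEntailed-relation P _≺_ S _≺ₐ_ _≺_ (λ _ _ _ → ⇔-id _) upper lower)
           (finitelyEntailed-relation P _≺_ S _≐_ _≡_ (λ _ _ _ → ⇔-id _)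
             (leftUnique⇒upperCone-finitelyGenerated P _≡_ λ p q → trans p (sym q))
             (leftUnique⇒upperCone-finitelyGenerated P (flip _≡_) λ p q → trans (sym p) q))
  ... | L , L⊆S , entails =
    L , L⊆S , λ σ → mk⇔ (λ solves e → solves e ∘ L⊆S e)
                        (λ solves e → entails σ solves e (byRelation e))
    where
      byRelation : ∀ e → ((λ e → ∃₂ λ s t → e ≡ (s ≺ₐ t)) ∪ (λ e → ∃₂ λ s t → e ≡ (s ≐ t))) e
      byRelation (s ≺ₐ t) = inj₁ (s , t , refl)
      byRelation (s ≐ t)  = inj₂ (s , t , refl)

  module _ (P : Set) (R : P → P → Set) (irreflexive : ∀ x → ¬ R x x)
           (transitive : ∀ {x y z} → R x y → R y z → R x z)
           (B : P → Set) (infinite : ¬ UpperConeFinitelyGenerated P R B) where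

    escapes-finite-generators : (G : List P) → (∀ g → g ∈ G → B g) →
                                ∃ λ x → UpL P R G x × ¬ Up P R B x
    escapes-finite-generators G G⊆B = dne λ ∄x →
      infinite (upperCone-generatedBy P R G G⊆B λ x above → dne λ ¬up → ∄x (x , above , ¬up))

    distinct-unrelated-generator : ∀ {x} → ¬ Up P R B x → ∃ λ b → B b × ¬ R b x × b ≢ x
    distinct-unrelated-generator {x} ¬up = dne λ ∄b → infinite (generatedBy-x ∄b)
      where
        generatedBy-x : ¬ (∃ λ b → B b × ¬ R b x × b ≢ x) → UpperConeFinitelyGenerated P R B
        generatedBy-x ∄b = upperCone-generatedBy P R (x ∷ []) (λ { _ (here refl) → Bx }) above
          where
            below-x : ∀ {b} → B b → b ≢ x → R b x
            below-x Bb b≢x = dne λ ¬Rbx → ∄b (_ , Bb , ¬Rbx , b≢x)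

            Bx : B x
            Bx = dne λ ¬Bx → ¬up λ b Bb → below-x Bb λ { refl → ¬Bx Bb }

            above : ∀ y → UpL P R (x ∷ []) y → Up P R B y
            above y x-below-y b Bb with dec (b ≡ x)
            ... | yes refl = x-below-y x (here refl)
            ... | no b≢x   = transitive (below-x Bb b≢x) (x-below-y x (here refl))

    Generators : Set
    Generators = ∃ λ (G : List P) → ∀ g → g ∈ G → B g

    -- a is recorded in G′ whenever it lies in B, so that no later b can equal it.
    record Step (G G′ : List P) : Set where
      field
        a b     : P
        b⊀a     : ¬ R b a
        b≢a     : b ≢ a
        a-above : UpL P R G a
        grows   : G ⊆ G′
        b∈G′    : b ∈ G′
        a∈G′    : B a → a ∈ G′

    _⟶_ : Generators → Generators → Set
    s ⟶ s′ = Step (proj₁ s) (proj₁ s′)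

    step : ∀ s → ∃ (s ⟶_)
    step (G , G⊆B) with escapes-finite-generators G G⊆B
    ... | a , a-above , ¬up with distinct-unrelated-generator ¬up
    ... | b , Bb , b⊀a , b≢a with dec (B a)
    ... | yes Ba =
      (b ∷ a ∷ G , λ { _ (here refl) → Bb ; _ (there (here refl)) → Ba
                     ; g (there (there g∈)) → G⊆B g g∈ }) ,
      record { a = a ; b = b ; b⊀a = b⊀a ; b≢a = b≢a ; a-above = a-above
             ; grows = there ∘ there ; b∈G′ = here refl ; a∈G′ = λ _ → there (here refl) }
    ... | no ¬Ba =
      (b ∷ G , λ { _ (here refl) → Bb ; g (there g∈) → G⊆B g g∈ }) ,
      record { a = a ; b = b ; b⊀a = b⊀a ; b≢a = b≢a ; a-above = a-above
             ; grows = there ; b∈G′ = here refl ; a∈G′ = ⊥-elim ∘ ¬Ba }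

    infinitelyGenerated⇒nonNoetherianPair :
      DependentChoice 0ℓ → ∃₂ λ a b → PairwiseDifferent P R a b × NonNoetherianPair P R a b
    infinitelyGenerated⇒nonNoetherianPair dc =
      a , b , (nonNoetherianPair⇒a-injective P R pair , nonNoetherianPair⇒b-injective P R pair , a≢b) ,
      pair
      where
        start : Generators
        start = [] , λ _ ()

        generators : ℕ → Generators
        generators = proj₁ (dc _⟶_ step start)

        steps : ∀ n → generators n ⟶ generators (suc n)
        steps = proj₂ (proj₂ (dc _⟶_ step start))

        a b : ℕ → P
        a = Step.a ∘ steps
        b = Step.b ∘ steps

        b∈B : ∀ k → B (b k)
        b∈B k = proj₂ (generators (suc k)) (b k) (Step.b∈G′ (steps k))

        recorded : ∀ {j i} → j < i → proj₁ (generators (suc j)) ⊆ proj₁ (generators i)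
        recorded = ⊆-chain (proj₁ ∘ generators) (Step.grows ∘ steps) ∘ ≤⇒≤′

        pair : NonNoetherianPair P R a b
        pair = Step.b⊀a ∘ steps ,
               λ i j j<i → Step.a-above (steps i) (b j) (recorded j<i (Step.b∈G′ (steps j)))

        a≢b : ∀ i k → a i ≢ b k
        a≢b i k ai≡bk with <-cmp i k
        ... | tri< i<k _ _ = Step.b⊀a (steps k) (subst (λ z → R z (a k)) ai≡bk
                               (Step.a-above (steps k) (a i) (recorded i<k (Step.a∈G′ (steps i) Bai))))
          where
            Bai : B (a i)
            Bai = subst B (sym ai≡bk) (b∈B k)
        ... | tri≈ _ refl _ = Step.b≢a (steps i) (sym ai≡bk)
        ... | tri> _ _ k<i =
          irreflexive (a i) (subst (λ z → R z (a i)) (sym ai≡bk) (proj₂ pair i k k<i))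

proposition4p5 : ExcludedMiddle (lsuc 0ℓ) → DependentChoice 0ℓ →
    (P : Set) (_≺_ : P → P → Set) → IsStrictPartialOrder _≡_ _≺_ →
      ((¬ EquationallyNoetherian P _≺_)
        ⇔ (PerfectlyNonNoetherian P _≺_ ⊎ NonNoetherianClique P _≺_))
      × ((PerfectlyNonNoetherian P _≺_ ⊎ NonNoetherianClique P _≺_)
        ⇔ Σ (P → Set) λ B →
            UpperConeInfinitelyGenerated P _≺_ B ⊎ LowerConeInfinitelyGenerated P _≺_ B)
proposition4p5 em dc P _≺_ isSPO =
  mk⇔ (sequences ∘ infiniteCone) (¬noetherian ∘ cone) , mk⇔ cone sequences
  where
    open IsStrictPartialOrder isSPO using (irrefl) renaming (trans to ≺-trans)

    _≻_ : P → P → Set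
    _≻_ = flip _≺_

    image-infinite : (R : P → P → Set) {a b : ℕ → P} → NonNoetherianPair P R a b →
                     ¬ UpperConeFinitelyGenerated P R (Image P R b)
    image-infinite R = nonNoetherianPair⇒image-infinitelyGenerated P R

    pair-of : (R : P → P → Set) → (∀ x → ¬ R x x) → (∀ {x y z} → R x y → R y z → R x z) →
              (B : P → Set) → ¬ UpperConeFinitelyGenerated P R B →
              ∃₂ λ a b → PairwiseDifferent P R a b × NonNoetherianPair P R a b
    pair-of R irreflexive transitive B infinite =
      infinitelyGenerated⇒nonNoetherianPair em P R irreflexive transitive B infinite dc

    Sequences : Set
    Sequences = PerfectlyNonNoetherian P _≺_ ⊎ NonNoetherianClique P _≺_

    InfiniteCone : Set₁
    InfiniteCone = Σ (P → Set) λ B →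
      UpperConeInfinitelyGenerated P _≺_ B ⊎ LowerConeInfinitelyGenerated P _≺_ B

    infiniteCone : ¬ EquationallyNoetherian P _≺_ → InfiniteCone
    infiniteCone ¬noeth = decidable-stable em λ ∄B → ¬noeth
      (finitelyGenerated⇒equationallyNoetherian em P _≺_
        (λ B → dne em λ infinite → ∄B (B , inj₁ infinite))
        (λ B → dne em λ infinite → ∄B (B , inj₂ infinite)))

    ¬noetherian : InfiniteCone → ¬ EquationallyNoetherian P _≺_
    ¬noetherian (B , inj₁ infinite) = infinitelyGenerated⇒¬equationallyNoetherian P _≺_ _≺_
      (λ c → inj₂ c ≺ₐ inj₁ zero) (λ _ _ → ⇔-id _) B infinite
    ¬noetherian (B , inj₂ infinite) = infinitelyGenerated⇒¬equationallyNoetherian P _≺_ _≻_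
      (λ c → inj₁ zero ≺ₐ inj₂ c) (λ _ _ → ⇔-id _) B infinite

    irreflexive : ∀ x → ¬ x ≺ x
    irreflexive _ = irrefl refl

    cone : Sequences → InfiniteCone
    cone (inj₁ (_ , b , _ , inj₁ pair)) = Image P _≻_ b , inj₂ (image-infinite _≻_ pair)
    cone (inj₁ (_ , b , _ , inj₂ pair)) = Image P _≺_ b , inj₁ (image-infinite _≺_ pair)
    cone (inj₂ (a , inj₁ clique)) = Image P _≻_ a , inj₂ (image-infinite _≻_ (irreflexive ∘ a , clique))
    cone (inj₂ (a , inj₂ clique)) = Image P _≺_ a , inj₁ (image-infinite _≺_ (irreflexive ∘ a , clique))

    sequences : InfiniteCone → Sequences
    sequences (B , inj₁ infinite) =
      let a , b , distinct , pair = pair-of _≺_ irreflexive ≺-trans B infinite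
      in inj₁ (a , b , distinct , inj₂ pair)
    sequences (B , inj₂ infinite) =
      let a , b , distinct , pair = pair-of _≻_ irreflexive (flip ≺-trans) B infinite
      in inj₁ (a , b , distinct , inj₁ pair)
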